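{- Let $(H,\omega)$ be a triangle-free edge-weighted graph whose edge weights are positive multiples of $a=45$, let $\tau=1080$, and let $G^*$ be the graph constructed from $(H,\omega)$. If $(H,\omega)$ admits a $\tau$-balancing order, then the linear mim-width of $G^*$ is at most $\frac{a+1}{a}\tau+107$.
   Context: Fix $a=45$, $\tau=1080$, $\gamma=135$, $b=6\tau(\tau+\gamma)+1$. A total order on $V(H)$ is $\tau$-balancing if every vertex $v$ has $\sum_{u\in N(v),u\prec v}\omega(uv)\le\tau$ and $\sum_{u\in N(v),v\prec u}\omega(uv)\le\tau$. Graph $G$: for each ordered pair $(u,v)$ with $uv\in E(H)$ an independent set $I(u,v)$ of $\omega(uv)$ vertices; $S(u)=\bigcup_{v\in N_H(u)}I(u,v)$; dummy edges: complete bipartite between $I(u,v)$ and $I(x,y)$ whenever $uv,xy\in E(H)$ share no endpoint; matching edges: a perfect matching between $I(u,v)$ and $I(v,u)$ for each $uv\in E(H)$; no other edges. Gadget $\mathcal G(u)$: partition each $I(u,v)$ into $I(u,v,1),\dots,I(u,v,a)$ of size $\omega(uv)/a$; with $v_1,\dots,v_k$ an enumeration of $N_H(u)$, let $L_i$ ($i\in[a]$) be a path on $I(u,v_1,i)\cup\dots\cup I(u,v_k,i)$ in this order, $L=L_1\dots L_a$ their concatenation, and $P_u$ the 1-subdivision of $L$ plus a new vertex adjacent to the last vertex of $L$. $Q_u$ is the concatenation of $b$ copies $P_u^1,\dots,P_u^b$ of $P_u$; for a vertex $x$ of $P_u$ (or a copy), $\mathrm{Copies}(x)$ is the set of its $b$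 copies. $\mathcal G(u)$ is $Q_u$ plus an edge between every pair $x,y$ in distinct copies $P_u^i,P_u^j$ unless $y\in N_{Q_u}[\mathrm{Copies}(x)]$. Graph $G^*$: the disjoint union of the gadgets $\mathcal G(u)$, $u\in V(H)$, plus, for every edge $xy\in E(G)$, all edges between $\mathrm{Copies}(x)$ and $\mathrm{Copies}(y)$. Linear mim-width: the minimum, over pairs $(T,f)$ where $T$ is a rooted full binary tree whose internal nodes form a path and $f$ a bijection from $V(G^*)$ to the leaves of $T$, of the maximum over edges $e$ of $T$ of the maximum size of an induced matching in the bipartite graph of edges of $G^*$ between the two sides of the cut induced by $e$. -}

module Defs where

open import Level using (0ℓ)
open import Data.Bool using (Bool; true; false; if_then_else_; _∧_)
open import Data.Nat using (ℕ; zero; suc; _+_; _*_; _∸_; _≤_; _<_; _/_; _%_)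
open import Data.Fin using (Fin) renaming (_≟_ to _≟ᶠ_)
open import Data.Nat.ListAction using (sum)
open import Data.List using (List; []; _∷_; map; take; drop; allFin)
open import Data.List.Membership.Propositional using (_∈_)
open import Data.List.Relation.Unary.Unique.Propositional using (Unique)
open import Data.Product using (Σ; ∃; _×_; _,_; proj₁; proj₂)
open import Data.Sum using (_⊎_)
open import Data.Empty using (⊥)
open import Relation.Nullary using (¬_; does)
open import Relation.Binary using (Rel; IsStrictTotalOrder)
open import Relation.Binary.PropositionalEquality using (_≡_; _≢_)

a : ℕ
a = 45

τ : ℕ
τ = 1080

γ : ℕ
γ = 135

b : ℕ
b = 6 * τ * (τ + γ) + 1

-- the bound (a+1)/a · τ + 107 (the division is exact: 45 ∣ 46·1080)
bound : ℕ
bound = ((a + 1) * τ) / a + 107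

record WGraph : Set where
  field
    n          : ℕ
    adj        : Fin n → Fin n → Bool
    adj-sym    : ∀ u v → adj u v ≡ adj v u
    adj-irrefl : ∀ u → adj u u ≡ false
    ω          : Fin n → Fin n → ℕ
    ω-sym      : ∀ u v → adj u v ≡ true → ω u v ≡ ω v u

module _ (H : WGraph) where
  open WGraph H

  TriangleFree : Set
  TriangleFree = ∀ u v w → adj u v ≡ true → adj v w ≡ true → adj u w ≡ true → ⊥

  WeightsPosMultOf : ℕ → Set
  WeightsPosMultOf d = ∀ u v → adj u v ≡ true → Σ ℕ λ k → ω u v ≡ d * suc k

  module _ {_≺_ : Rel (Fin n) 0ℓ} (sto : IsStrictTotalOrder _≡_ _≺_) where
    open IsStrictTotalOrder sto using (_<?_)

    backWeight : Fin n → ℕ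
    backWeight v = sum (map (λ u → if adj u v ∧ does (u <? v) then ω u v else 0) (allFin n))

    fwdWeight : Fin n → ℕ
    fwdWeight v = sum (map (λ u → if adj u v ∧ does (v <? u) then ω u v else 0) (allFin n))

  Balancing : ℕ → (_≺_ : Rel (Fin n) 0ℓ) → IsStrictTotalOrder _≡_ _≺_ → Set
  Balancing t _ sto = ∀ v → backWeight sto v ≤ t × fwdWeight sto v ≤ t

  HasBalancingOrder : ℕ → Set₁
  HasBalancingOrder t =
    Σ (Rel (Fin n) 0ℓ) λ _≺_ → Σ (IsStrictTotalOrder _≡_ _≺_) λ sto → Balancing t _≺_ sto

  -- |I(u,v,i)| = ω(uv)/a
  m : Fin n → Fin n → ℕ
  m u v = ω u v / a

  EnumOK : (Fin n → List (Fin n)) → Set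
  EnumOK enum = ∀ u → Unique (enum u) ×
    (∀ v → (v ∈ enum u → adj u v ≡ true) × (adj u v ≡ true → v ∈ enum u))

  -- The vertex (u,v,i,k) of G is the k-th vertex of I(u,v,i)  (i < a, k < ω(uv)/a).
  -- A perfect matching between I(u,v) and I(v,u) for every edge uv, given
  -- by mutually inverse maps.
  MatchOK : (Fin n → Fin n → ℕ × ℕ → ℕ × ℕ) → Set
  MatchOK match = ∀ u v i k → adj u v ≡ true → i < a → k < m u v →
    proj₁ (match u v (i , k)) < a × proj₂ (match u v (i , k)) < m v u ×
    match v u (match u v (i , k)) ≡ (i , k)

-- vertices of G: (u, v, i, k) stands for the k-th vertex of I(u,v,i)
record GV (n : ℕ) : Set where
  constructor gv
  field
    gu gv' : Fin n
    gi gk  : ℕ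

-- vertices of G*: (u, q) is the q-th vertex (along the path Q_u) of the gadget 𝒢(u)
record SV (n : ℕ) : Set where
  constructor sv
  field
    su : Fin n
    sq : ℕ

module Construction (H : WGraph) (enum : Fin (WGraph.n H) → List (Fin (WGraph.n H)))
                    (match : Fin (WGraph.n H) → Fin (WGraph.n H) → ℕ × ℕ → ℕ × ℕ) where
  open WGraph H

  ValidG : GV n → Set
  ValidG (gv u v i k) = adj u v ≡ true × i < a × k < m H u v

  DisjointEnds : Fin n → Fin n → Fin n → Fin n → Set
  DisjointEnds u v x y = u ≢ x × u ≢ y × v ≢ x × v ≢ y

  MatchEdge : GV n → GV n → Set
  MatchEdge (gv u v i k) (gv x y i' k') = x ≡ v × y ≡ u × match u v (i , k) ≡ (i' , k')

  -- edges of G (dummy edges and matching edges)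
  EdgeG : GV n → GV n → Set
  EdgeG p@(gv u v _ _) q@(gv x y _ _) =
    ValidG p × ValidG q × (DisjointEnds u v x y ⊎ MatchEdge p q ⊎ MatchEdge q p)

  -- D u = Σ_{v ∈ N(u)} ω(uv)/a  = number of vertices of each L_i
  D : Fin n → ℕ
  D u = sum (map (m H u) (enum u))

  -- |L| = Σ_{v ∈ N(u)} ω(uv)
  ℓ : Fin n → ℕ
  ℓ u = a * D u

  -- number of vertices of P_u : 2|L| - 1 vertices of the 1-subdivision of L,
  -- plus the new pendant vertex
  p : Fin n → ℕ
  p u = suc (2 * ℓ u ∸ 1)

  pre : List (Fin n) → (Fin n → ℕ) → Fin n → ℕ
  pre [] f v = 0
  pre (w ∷ ws) f v = if does (w ≟ᶠ v) then 0 else f w + pre ws f v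

  -- position in L = L_1 ⋯ L_a of the vertex (u,v,i,k):
  -- L_i is I(u,v_1,i) ⋯ I(u,v_k,i), each part traversed in order of k
  Lpos : GV n → ℕ
  Lpos (gv u v i k) = i * D u + pre (enum u) (m H u) v + k

  -- position in P_u of a vertex of L (positions 0 … p u - 1 along the path P_u;
  -- subdivision vertices at odd positions, the new vertex at p u - 1)
  Ppos : GV n → ℕ
  Ppos x = 2 * Lpos x

  ValidS : SV n → Set
  ValidS (sv u q) = q < b * p u

  -- q' ∈ N_{Q_u}[Copies(x)] where x is the vertex at position s of P_u
  InNCopies : Fin n → ℕ → ℕ → Set
  InNCopies u s q' = Σ ℕ λ c → c < b ×
    (q' ≡ c * p u + s ⊎ suc q' ≡ c * p u + s ⊎ q' ≡ suc (c * p u + s))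

  -- edges of the gadget 𝒢(u): edges of Q_u (Q_u is the path through positions
  -- 0,1,…,b·p u - 1, copy c occupying positions c·p u, …, c·p u + p u - 1), and
  -- edges between distinct copies unless excluded by N_{Q_u}[Copies(·)]
  GadgetEdge : Fin n → ℕ → ℕ → Set
  GadgetEdge u q q' =
    (suc q ≡ q' ⊎ suc q' ≡ q) ⊎
    ((q / p u ≢ q' / p u) × ¬ InNCopies u (q % p u) q' × ¬ InNCopies u (q' % p u) q)

  IsCopy : SV n → GV n → Set
  IsCopy (sv u q) x = u ≡ GV.gu x × Σ ℕ λ c → c < b × q ≡ c * p u + Ppos x

  EdgeS : SV n → SV n → Set
  EdgeS s@(sv u q) t@(sv u' q') = ValidS s × ValidS t ×
    ((u ≡ u' × GadgetEdge u q q') ⊎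
     Σ (GV n) λ x → Σ (GV n) λ y → EdgeG x y × IsCopy s x × IsCopy t y)

  -- the maximum size of an induced matching in the bipartite graph of the
  -- edges of G* between A and B is at most k
  MimLe : (SV n → Set) → (SV n → Set) → ℕ → Set
  MimLe A B k = ∀ r (xs ys : Fin r → SV n) →
    (∀ i → A (xs i)) → (∀ i → B (ys i)) → (∀ i → EdgeS (xs i) (ys i)) →
    (∀ i j → i ≢ j → ¬ EdgeS (xs i) (ys j)) → r ≤ k

  -- A linear branch decomposition (T,f): T a caterpillar, f a bijection from
  -- V(G*) to its leaves, recorded by the list of V(G*) in the order of the
  -- leaves along the spine.
  LinearLayout : List (SV n) → Set
  LinearLayout ls = Unique ls × (∀ s → (s ∈ ls → ValidS s) × (ValidS s → s ∈ ls))

  -- the cuts induced by the edges of the caterpillar: spine edges induce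
  -- (prefix, suffix), leaf edges induce ({s}, rest)
  WidthLe : List (SV n) → ℕ → Set
  WidthLe ls k =
    (∀ j → MimLe (λ s → s ∈ take j ls) (λ s → s ∈ drop j ls) k) ×
    (∀ s → s ∈ ls → MimLe (λ t → t ≡ s) (λ t → ValidS t × t ≢ s) k)

  LinMimWidthLe : ℕ → Set
  LinMimWidthLe k = Σ (List (SV n)) λ ls → LinearLayout ls × WidthLe ls k

{-# OPTIONS --safe #-}
-- Lay out G* gadget by gadget, following a τ-balancing order ≺ of H, and each gadget along its
-- path Q_u. Take a cut of this layout and an induced matching across it, and count its edges by
-- injective codes into ℕ, according to the kind of each edge.
--   * Gadget edges all lie in one gadget. At most one is an edge of Q_u. For the others, all copy
--     indices on the left are at most those on the right; split them into two classes so that the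
--     left and right copy indices of two edges in one class always differ. For two edges of a class
--     to be non-adjacent, the left residue in P_u of each must then be a cyclic neighbour of the
--     right residue of the other, so a class has at most 1 + 3·3 edges: 21 in all.
--   * Copies of dummy edges of G have end pairs X, Y in H with X_i ∩ Y_i = ∅ and X_i ∩ Y_j ≠ ∅:
--     at most 1 + 2·2·2 = 9.
--   * Copies of matching edges of G lie over pairwise intersecting edges of H, which share a
--     centre c because H is triangle-free. Each such edge has an anchor in S(c): on the left of
--     the cut when c ≺ v and on the right when v ≺ c, where v is its other end in H. The gadget of c
--     forces the left layers i to lie below the right ones, hence below and above a threshold s
--     respectively. Counting positions in I(c, v) and using the balancing condition at c, there are
--     at most Σ_v ((s+1)·[c ≺ v] + (a−s)·[v ≺ c])·ω(cv)/a ≤ (a+1)·τ/a of them.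
-- So every cut has an induced matching of size at most 21 + 9 + (a+1)τ/a ≤ (a+1)τ/a + 107.
module Submission where

open import Defs
open import Level using (0ℓ)
open import Data.Bool using (Bool; true; false; _∧_; if_then_else_)
import Data.Bool.Properties as Bool
open import Data.Empty using (⊥)
open import Data.Fin using (Fin; zero; suc) renaming (_≟_ to _≟ᶠ_)
open import Data.Fin.Properties using (any?; all?; ¬∀⟶∃¬; injective⇒≤; fromℕ<-injective)
open import Data.List using (List; []; _∷_; map; filter; take; drop; allFin; upTo; concatMap)
open import Data.List.Membership.Propositional using (_∈_; lose)
open import Data.List.Membership.Propositional.Properties
  using (∈-map⁺; ∈-map⁻; ∈-filter⁺; ∈-filter⁻; ∈-allFin; ∈-upTo⁺; ∈-upTo⁻; ∈-concatMap⁺; ∈-concatMap⁻)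
open import Data.List.Relation.Binary.Permutation.Propositional using (↭-sym; ↭⇒↭ₛ)
open import Data.List.Relation.Binary.Permutation.Propositional.Properties using (∈-resp-↭)
open import Data.List.Relation.Binary.Permutation.Setoid.Properties using (Unique-resp-↭)
import Data.List.Relation.Unary.All as All
import Data.List.Relation.Unary.All.Properties as Allₚ
open import Data.List.Relation.Unary.AllPairs as AllPairs using (AllPairs; []; _∷_)
import Data.List.Relation.Unary.AllPairs.Properties as AllPairsₚ
open import Data.List.Relation.Unary.Any as Any using (here; there)
open import Data.List.Relation.Unary.Sorted.TotalOrder.Properties using (Sorted⇒AllPairs)
open import Data.List.Relation.Unary.Unique.Propositional using (Unique)
open import Data.List.Relation.Unary.Unique.Propositional.Properties using (allFin⁺)
import Data.List.Sort
open import Data.Nat using (ℕ; zero; suc; _+_; _*_; _∸_; _≤_; _<_; _/_; _%_; z≤n; s≤s; s≤s⁻¹; NonZero)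
open import Data.Nat.DivMod
open import Data.Nat.Divisibility using (n∣m*n)
open import Data.Nat.ListAction using (sum)
open import Data.Nat.Properties
open import Algebra.Properties.CommutativeSemigroup +-commutativeSemigroup using (interchange)
open import Data.List.Extrema ≤-totalOrder using (max; xs≤max; max≤v⁺)
open import Data.Product using (∃; _×_; _,_; proj₁; proj₂)
open import Data.Sum using (_⊎_; inj₁; inj₂; [_,_]′)
open import Data.Unit using (⊤; tt)
open import Function using (_∘_; id)
open import Relation.Binary using (Rel; IsStrictTotalOrder; DecTotalOrder; DecidableEquality)
import Relation.Binary.Construct.StrictToNonStrict as StrictToNonStrict
open import Relation.Binary.PropositionalEquality
  using (_≡_; _≢_; ≢-sym; refl; sym; trans; cong; cong₂; subst; subst₂; setoid; module ≡-Reasoning)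
open import Relation.Nullary using (¬_; Dec; yes; no; does; contradiction)
open import Relation.Nullary.Decidable using (decidable-stable; _×-dec_; _⊎-dec_; _→-dec_; ¬?; dec-true)
open import Relation.Unary using (Pred; Decidable; U; _⊆_; _∩_; ∁)
open import Relation.Unary.Properties using (_∩?_)

open GV
open SV

-- Counting by injective codes

module _ {r : ℕ} where

  record AtMost (P : Pred (Fin r) 0ℓ) (N : ℕ) : Set where
    field
      code           : Fin r → ℕ
      code<          : ∀ {i} → P i → code i < N
      code-injective : ∀ {i j} → P i → P j → code i ≡ code j → i ≡ j

  open AtMost

  private variable
    P Q S : Pred (Fin r) 0ℓ
    M N : ℕ

  atMost⇒≤ : (∀ i → P i) → AtMost P N → r ≤ N
  atMost⇒≤ all A = injective⇒≤ λ {i} {j} eq →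
    code-injective A (all i) (all j)
      (fromℕ<-injective _ _ (code< A (all i)) (code< A (all j)) eq)

  atMost-⊆ : P ⊆ Q → AtMost Q N → AtMost P N
  atMost-⊆ P⊆Q A = record
    { code           = code A
    ; code<          = code< A ∘ P⊆Q
    ; code-injective = λ p q → code-injective A (P⊆Q p) (P⊆Q q)
    }

  atMost-≤ : N ≤ M → AtMost P N → AtMost P M
  atMost-≤ N≤M A = record
    { code           = code A
    ; code<          = λ p → <-≤-trans (code< A p) N≤M
    ; code-injective = code-injective A
    }

  atMost-empty : (∀ {i} → ¬ P i) → AtMost P 0
  atMost-empty ∄ = record
    { code           = λ _ → 0
    ; code<          = λ p → contradiction p ∄
    ; code-injective = λ p → contradiction p ∄
    }

  atMost-subsingleton : (∀ {i j} → P i → P j → i ≡ j) → AtMost P 1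
  atMost-subsingleton unique = record
    { code           = λ _ → 0
    ; code<          = λ _ → s≤s z≤n
    ; code-injective = λ p q _ → unique p q
    }

  atMost-split : Decidable S → AtMost (P ∩ S) N → AtMost (P ∩ ∁ S) M → AtMost P (N + M)
  atMost-split {S = S} {P = P} {N = N} {M = M} S? A B = record
    { code = code′ ; code< = code′< ; code-injective = code′-injective }
    where
    code′ : Fin r → ℕ
    code′ i with S? i
    ... | yes _ = code A i
    ... | no  _ = N + code B i

    code′< : ∀ {i} → P i → code′ i < N + M
    code′< {i} p with S? i
    ... | yes s = <-≤-trans (code< A (p , s)) (m≤m+n N M)
    ... | no ¬s = +-monoʳ-< N (code< B (p , ¬s))

    code′-injective : ∀ {i j} → P i → P j → code′ i ≡ code′ j → i ≡ j
    code′-injective {i} {j} p q eq with S? i | S? j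
    ... | yes s | yes t = code-injective A (p , s) (q , t) eq
    ... | no ¬s | no ¬t = code-injective B (p , ¬s) (q , ¬t) (+-cancelˡ-≡ N _ _ eq)
    ... | yes s | no _  = contradiction eq (<⇒≢ (<-≤-trans (code< A (p , s)) (m≤m+n N _)))
    ... | no _  | yes t = contradiction (sym eq) (<⇒≢ (<-≤-trans (code< A (q , t)) (m≤m+n N _)))

  atMost-partition : ∀ {C : Set} → DecidableEquality C →
    (cls : Fin r → C) (cs : List C) (Nc : C → ℕ) →
    (∀ {i} → P i → cls i ∈ cs) → (∀ c → AtMost (P ∩ (λ i → cls i ≡ c)) (Nc c)) →
    AtMost P (sum (map Nc cs))
  atMost-partition _≟ᶜ_ cls [] Nc ∈cs A = atMost-empty λ p → contradiction (∈cs p) λ ()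
  atMost-partition {P = P} _≟ᶜ_ cls (c ∷ cs) Nc ∈cs A =
    atMost-split (λ i → cls i ≟ᶜ c) (A c)
      (atMost-partition _≟ᶜ_ cls cs Nc ∈cs′ λ c′ → atMost-⊆ (λ ((p , _) , e) → p , e) (A c′))
    where
    ∈cs′ : ∀ {i} → (P ∩ ∁ (λ i → cls i ≡ c)) i → cls i ∈ cs
    ∈cs′ (p , ≢c) with ∈cs p
    ... | here e  = contradiction e ≢c
    ... | there m = m

  atMost-inhabited : Decidable P → (∀ {f} → P f → AtMost P N) → AtMost P N
  atMost-inhabited P? A with any? P?
  ... | yes (_ , pf) = A pf
  ... | no ∄         = atMost-≤ z≤n (atMost-empty λ p → ∄ (_ , p))

  atMost-insert : (f : Fin r) → AtMost (P ∩ (_≢ f)) N → AtMost P (suc N)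
  atMost-insert f =
    atMost-split (_≟ᶠ f) (atMost-subsingleton λ (_ , i≡f) (_ , j≡f) → trans i≡f (sym j≡f))

  atMost-crossing : ∀ {A : Set} → Decidable P → (g h : Fin r → A) →
    (∀ {i j} → P i → P j → i ≢ j → g i ≡ h j) → (∀ {i} → P i → g i ≢ h i) → AtMost P 2
  atMost-crossing P? g h cross diagonal = atMost-inhabited P? λ {f} pf →
    atMost-insert f (atMost-subsingleton λ {i} {j} (pi , i≢f) (pj , j≢f) →
      decidable-stable (i ≟ᶠ j) λ i≢j →
        diagonal pj (trans (cross pj pf j≢f) (trans (sym (cross pi pf i≢f)) (cross pi pj i≢j))))

module InducedMatching {V : Set} (E : V → V → Set) {r : ℕ} (xs ys : Fin r → V)
                       (induced : ∀ i j → i ≢ j → ¬ E (xs i) (ys j)) where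

  edge⇒≡ : ∀ {i j} → E (xs i) (ys j) → i ≡ j
  edge⇒≡ {i} {j} e = decidable-stable (i ≟ᶠ j) λ i≢j → induced i j i≢j e

  common-source⇒≤1 : ∀ {s} → (∀ i → xs i ≡ s) → (∀ i → E (xs i) (ys i)) → r ≤ 1
  common-source⇒≤1 same edge = atMost⇒≤ {P = U} _ (atMost-subsingleton λ {i} {j} _ _ →
    edge⇒≡ (subst (λ x → E x (ys j)) (trans (same j) (sym (same i))) (edge j)))

-- Arithmetic

[m*n+o]%n≡o : ∀ m {n o} .{{_ : NonZero n}} → o < n → (m * n + o) % n ≡ o
[m*n+o]%n≡o m {n} {o} o<n = begin
  (m * n + o) % n ≡⟨ cong (_% n) (+-comm (m * n) o) ⟩
  (o + m * n) % n ≡⟨ [m+kn]%n≡m%n o m n ⟩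
  o % n           ≡⟨ m<n⇒m%n≡m o<n ⟩
  o               ∎
  where open ≡-Reasoning

[m*n+o]/n≡m : ∀ m {n o} .{{_ : NonZero n}} → o < n → (m * n + o) / n ≡ m
[m*n+o]/n≡m m {n} {o} o<n = begin
  (m * n + o) / n   ≡⟨ +-distrib-/-∣ˡ o (n∣m*n m) ⟩
  m * n / n + o / n ≡⟨ cong₂ _+_ (m*n/n≡m m n) (m<n⇒m/n≡0 o<n) ⟩
  m + 0             ≡⟨ +-identityʳ m ⟩
  m                 ∎
  where open ≡-Reasoning

*+-injective : ∀ x x′ {n y y′} → y < n → y′ < n → x * n + y ≡ x′ * n + y′ → x ≡ x′ × y ≡ y′
*+-injective x x′ {suc n} y<n y′<n eq =
  trans (sym ([m*n+o]/n≡m x y<n)) (trans (cong (_/ suc n) eq) ([m*n+o]/n≡m x′ y′<n)) ,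
  trans (sym ([m*n+o]%n≡o x y<n)) (trans (cong (_% suc n) eq) ([m*n+o]%n≡o x′ y′<n))

m*n+o<k*n : ∀ {m n o k} → m < k → o < n → m * n + o < k * n
m*n+o<k*n {m} {n} {o} {k} m<k o<n = begin-strict
  m * n + o <⟨ +-monoʳ-< (m * n) o<n ⟩
  m * n + n ≡⟨ +-comm (m * n) n ⟩
  suc m * n ≤⟨ *-monoˡ-≤ n m<k ⟩
  k * n     ∎
  where open ≤-Reasoning

*-sum-map-≤ : ∀ {A : Set} (xs : List A) {c d e : ℕ} (f g h : A → ℕ) →
  (∀ x → c * f x ≤ d * g x + e * h x) →
  c * sum (map f xs) ≤ d * sum (map g xs) + e * sum (map h xs)
*-sum-map-≤ [] {c} f g h _ = ≤-trans (≤-reflexive (*-zeroʳ c)) z≤n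
*-sum-map-≤ (x ∷ xs) {c} {d} {e} f g h pointwise = begin
  c * (f x + Σf)                  ≡⟨ *-distribˡ-+ c (f x) Σf ⟩
  c * f x + c * Σf                ≤⟨ +-mono-≤ (pointwise x) (*-sum-map-≤ xs {c} {d} {e} f g h pointwise) ⟩
  d * g x + e * h x + (d * Σg + e * Σh) ≡⟨ interchange (d * g x) (e * h x) (d * Σg) (e * Σh) ⟩
  d * g x + d * Σg + (e * h x + e * Σh) ≡⟨ cong₂ _+_ (*-distribˡ-+ d (g x) Σg) (*-distribˡ-+ e (h x) Σh) ⟨
  d * (g x + Σg) + e * (h x + Σh) ∎
  where
  open ≤-Reasoning
  Σf Σg Σh : ℕ
  Σf = sum (map f xs)
  Σg = sum (map g xs)
  Σh = sum (map h xs)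

separator : ∀ {r} {P Q : Pred (Fin r) 0ℓ} → Decidable P → (A B : Fin r → ℕ) {N : ℕ} →
  (∀ {i} → P i → A i ≤ N) → (∀ {i j} → P i → Q j → A i ≤ B j) →
  ∃ λ s → s ≤ N × (∀ {i} → P i → A i ≤ s) × (∀ {j} → Q j → s ≤ B j)
separator {r} {P} P? A B A≤N A≤B =
  max 0 values ,
  max≤v⁺ z≤n (All.tabulate (below A≤N)) ,
  (λ p → All.lookup (xs≤max 0 values) (∈-map⁺ A (∈-filter⁺ P? {xs = allFin r} (∈-allFin _) p))) ,
  (λ q → max≤v⁺ z≤n (All.tabulate (below λ p → A≤B p q)))
  where
  values : List ℕ
  values = map A (filter P? (allFin r))
  below : ∀ {t} → (∀ {i} → P i → A i ≤ t) → ∀ {v} → v ∈ values → v ≤ t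
  below A≤t v∈ with ∈-map⁻ A v∈
  ... | _ , i∈ , refl = A≤t (proj₂ (∈-filter⁻ P? {xs = allFin r} i∈))

m*[n*[o/m]]≤n*o : ∀ m n o .{{_ : NonZero m}} → m * (n * (o / m)) ≤ n * o
m*[n*[o/m]]≤n*o m n o = begin
  m * (n * (o / m)) ≡⟨ *-assoc m n (o / m) ⟨
  m * n * (o / m)   ≡⟨ cong (_* (o / m)) (*-comm m n) ⟩
  n * m * (o / m)   ≡⟨ *-assoc n m (o / m) ⟩
  n * (m * (o / m)) ≡⟨ cong (n *_) (*-comm m (o / m)) ⟩
  n * (o / m * m)   ≤⟨ *-monoʳ-≤ n (m/n*n≤m o m) ⟩
  n * o             ∎
  where open ≤-Reasoning

[1+m%n]%n≡[1+m]%n : ∀ m n .{{_ : NonZero n}} → suc (m % n) % n ≡ suc m % n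
[1+m%n]%n≡[1+m]%n m n = begin
  (1 + m % n) % n         ≡⟨ %-distribˡ-+ 1 (m % n) n ⟩
  (1 % n + m % n % n) % n ≡⟨ cong (λ z → (1 % n + z) % n) (m%n%n≡m%n m n) ⟩
  (1 % n + m % n) % n     ≡⟨ %-distribˡ-+ 1 m n ⟨
  (1 + m) % n             ∎
  where open ≡-Reasoning

suc-%-injective : ∀ {n y y′} .{{_ : NonZero n}} → y < n → y′ < n → suc y % n ≡ suc y′ % n → y ≡ y′
suc-%-injective {n} {y} {y′} y<n y′<n eq =
  suc-injective (cases (m≤n⇒m<n∨m≡n y<n) (m≤n⇒m<n∨m≡n y′<n))
  where
  wraps : ∀ {z} → suc z ≡ n → suc z % n ≡ 0
  wraps refl = n%n≡0 n
  cases : suc y < n ⊎ suc y ≡ n → suc y′ < n ⊎ suc y′ ≡ n → suc y ≡ suc y′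
  cases (inj₁ y+1<n) (inj₁ y′+1<n) = trans (sym (m<n⇒m%n≡m y+1<n)) (trans eq (m<n⇒m%n≡m y′+1<n))
  cases (inj₂ y+1≡n) (inj₂ y′+1≡n) = trans y+1≡n (sym y′+1≡n)
  cases (inj₁ y+1<n) (inj₂ y′+1≡n) =
    contradiction (trans (sym (m<n⇒m%n≡m y+1<n)) (trans eq (wraps y′+1≡n))) λ ()
  cases (inj₂ y+1≡n) (inj₁ y′+1<n) =
    contradiction (trans (sym (m<n⇒m%n≡m y′+1<n)) (trans (sym eq) (wraps y+1≡n))) λ ()

module _ (d : ℕ) .{{_ : NonZero d}} where

  CyclicStep : Fin 3 → ℕ → ℕ → Set
  CyclicStep zero          x y = y ≡ x
  CyclicStep (suc zero)    x y = y ≡ suc x % d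
  CyclicStep (suc (suc _)) x y = x ≡ suc y % d

  cyclicStep? : ∀ t x y → Dec (CyclicStep t x y)
  cyclicStep? zero          x y = y ≟ x
  cyclicStep? (suc zero)    x y = y ≟ suc x % d
  cyclicStep? (suc (suc _)) x y = x ≟ suc y % d

  cyclicStep-functional : ∀ t {x y y′} → y < d → y′ < d →
    CyclicStep t x y → CyclicStep t x y′ → y ≡ y′
  cyclicStep-functional zero          _   _    y≡x  y′≡x = trans y≡x (sym y′≡x)
  cyclicStep-functional (suc zero)    _   _    y≡   y′≡  = trans y≡ (sym y′≡)
  cyclicStep-functional (suc (suc _)) y<d y′<d x≡   x≡′  = suc-%-injective y<d y′<d (trans (sym x≡) x≡′)

  CyclicNear : ℕ → ℕ → Set
  CyclicNear x y = ∃ λ t → CyclicStep t x y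

  cyclicNear? : ∀ x y → Dec (CyclicNear x y)
  cyclicNear? x y = any? λ t → cyclicStep? t x y

  cyclicNear-sym : ∀ {x y} → CyclicNear x y → CyclicNear y x
  cyclicNear-sym (zero , y≡x)       = zero , sym y≡x
  cyclicNear-sym (suc zero , y≡)    = suc (suc zero) , y≡
  cyclicNear-sym (suc (suc _) , x≡) = suc zero , x≡

  nearTag : ℕ → ℕ → Fin 3
  nearTag x y with cyclicNear? x y
  ... | yes (t , _) = t
  ... | no _        = zero

  nearTag-step : ∀ {x y} → CyclicNear x y → CyclicStep (nearTag x y) x y
  nearTag-step {x} {y} near with cyclicNear? x y
  ... | yes (_ , step) = step
  ... | no ¬near       = contradiction near ¬near

  nearTag-injective : ∀ {x y y′} → y < d → y′ < d → CyclicNear x y → CyclicNear x y′ →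
    nearTag x y ≡ nearTag x y′ → y ≡ y′
  nearTag-injective y<d y′<d near near′ same-tag = cyclicStep-functional _ y<d y′<d (nearTag-step near)
    (subst (λ t → CyclicStep t _ _) (sym same-tag) (nearTag-step near′))

-- Two-element sets and intersecting edges

module Pairs {A : Set} (_≟_ : DecidableEquality A) where

  infix 4 _∈₂_ _∈₂?_

  _∈₂_ : A → A × A → Set
  e ∈₂ (u , v) = e ≡ u ⊎ e ≡ v

  _∈₂?_ : ∀ e X → Dec (e ∈₂ X)
  e ∈₂? (u , v) = (e ≟ u) ⊎-dec (e ≟ v)

  Meets : A × A → A × A → Set
  Meets X Y = ∃ λ e → e ∈₂ X × e ∈₂ Y

  meets? : ∀ X Y → Dec (Meets X Y)
  meets? X (y₁ , y₂) with y₁ ∈₂? X | y₂ ∈₂? X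
  ... | yes y₁∈X | _        = yes (y₁ , y₁∈X , inj₁ refl)
  ... | no _     | yes y₂∈X = yes (y₂ , y₂∈X , inj₂ refl)
  ... | no y₁∉X  | no y₂∉X  = no λ where
    (_ , e∈X , inj₁ refl) → y₁∉X e∈X
    (_ , e∈X , inj₂ refl) → y₂∉X e∈X

  meets-sym : ∀ {X Y} → Meets X Y → Meets Y X
  meets-sym (e , e∈X , e∈Y) = e , e∈Y , e∈X

  pick : A × A → A × A → A
  pick X (y₁ , y₂) with y₁ ∈₂? X
  ... | yes _ = y₁
  ... | no  _ = y₂

  pick-∈₂ : ∀ {X Y} → Meets X Y → pick X Y ∈₂ X
  pick-∈₂ {X} {y₁ , y₂} (e , e∈X , e∈Y) with y₁ ∈₂? X
  ... | yes y₁∈X = y₁∈X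
  ... | no y₁∉X with e∈Y
  ...   | inj₁ refl = contradiction e∈X y₁∉X
  ...   | inj₂ refl = e∈X

  pick-∈ : ∀ X Y → pick X Y ∈ proj₁ Y ∷ proj₂ Y ∷ []
  pick-∈ X (y₁ , y₂) with y₁ ∈₂? X
  ... | yes _ = here refl
  ... | no  _ = there (here refl)

  other : A × A → A → A
  other (u , v) e with e ≟ u
  ... | yes _ = v
  ... | no  _ = u

  other-∈₂ : ∀ X e → other X e ∈₂ X
  other-∈₂ (u , v) e with e ≟ u
  ... | yes _ = inj₂ refl
  ... | no  _ = inj₁ refl

  ∈₂-other : ∀ {X e e′} → e ∈₂ X → e′ ∈₂ X → e′ ≡ e ⊎ e′ ≡ other X e
  ∈₂-other {u , v} {e} e∈X e′∈X with e ≟ u | e∈X | e′∈X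
  ... | yes refl | _         | inj₁ refl = inj₁ refl
  ... | yes _    | _         | inj₂ refl = inj₂ refl
  ... | no e≢u   | inj₁ e≡u  | _         = contradiction e≡u e≢u
  ... | no _     | inj₂ refl | inj₁ refl = inj₂ refl
  ... | no _     | inj₂ refl | inj₂ refl = inj₁ refl

  -- X, Y and X′, Y′: the end pairs of two edges of a dummy class, with α ∈ X ∩ X′ and β ∈ Y ∩ Y′.
  crossing-others : ∀ {α β X Y X′ Y′} → α ∈₂ X → α ∈₂ X′ → β ∈₂ Y → β ∈₂ Y′ →
    ¬ Meets X Y → ¬ Meets X′ Y′ → Meets X Y′ → other X α ≡ other Y′ β
  crossing-others α∈X α∈X′ β∈Y β∈Y′ ¬XY ¬X′Y′ (e , e∈X , e∈Y′) with ∈₂-other α∈X e∈X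
  ... | inj₁ refl = contradiction (e , α∈X′ , e∈Y′) ¬X′Y′
  ... | inj₂ e≡oX with ∈₂-other β∈Y′ e∈Y′
  ...   | inj₁ refl = contradiction (e , e∈X , β∈Y) ¬XY
  ...   | inj₂ e≡oY = trans (sym e≡oX) e≡oY

module _ (H : WGraph) where
  open WGraph H
  open Pairs (_≟ᶠ_ {n})

  IsEdge : Fin n × Fin n → Set
  IsEdge (u , v) = adj u v ≡ true

  adjacent-in-edge : ∀ {X e e′} → IsEdge X → e ∈₂ X → e′ ∈₂ X → e ≢ e′ → adj e e′ ≡ true
  adjacent-in-edge {u , v} uv (inj₁ refl) (inj₂ refl) _    = uv
  adjacent-in-edge {u , v} uv (inj₂ refl) (inj₁ refl) _    = trans (adj-sym v u) uv
  adjacent-in-edge {u , v} uv (inj₁ refl) (inj₁ refl) e≢e′ = contradiction refl e≢e′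
  adjacent-in-edge {u , v} uv (inj₂ refl) (inj₂ refl) e≢e′ = contradiction refl e≢e′

  intersecting-edges-share-vertex : TriangleFree H → ∀ {r} {P : Pred (Fin r) 0ℓ} → Decidable P →
    (E : Fin r → Fin n × Fin n) → (∀ {i} → P i → IsEdge (E i)) →
    (∀ {i j} → P i → P j → Meets (E i) (E j)) →
    ∀ {f} → P f → ∃ λ c → ∀ {i} → P i → c ∈₂ E i
  intersecting-edges-share-vertex triangle-free {r} {P} P? E edge meets {f} pf
    with all? (λ i → P? i →-dec (proj₁ (E f) ∈₂? E i))
  ... | yes p∈all = proj₁ (E f) , p∈all _
  ... | no ¬p∈all = q , λ {j} → q∈ j
    where
    p q : Fin n
    p = proj₁ (E f)
    q = proj₂ (E f)
    witness : ∃ λ k → ¬ (P k → p ∈₂ E k)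
    witness = ¬∀⟶∃¬ r _ (λ i → P? i →-dec (p ∈₂? E i)) ¬p∈all
    k : Fin r
    k = proj₁ witness
    pk : P k
    pk = decidable-stable (P? k) λ ¬pk → proj₂ witness λ pk → contradiction pk ¬pk
    p∉Ek : ¬ p ∈₂ E k
    p∉Ek p∈Ek = proj₂ witness λ _ → p∈Ek
    end-of-f : ∀ {i} → P i → ¬ p ∈₂ E i → q ∈₂ E i
    end-of-f pi p∉Ei with meets pi pf
    ... | e , e∈Ei , inj₁ refl = contradiction e∈Ei p∉Ei
    ... | e , e∈Ei , inj₂ refl = e∈Ei
    q∈Ek : q ∈₂ E k
    q∈Ek = end-of-f pk p∉Ek
    q∈ : ∀ j → P j → q ∈₂ E j
    q∈ j pj = decidable-stable (q ∈₂? E j) λ q∉Ej → triangle q∉Ej (meets pj pk)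
      where
      p∈Ej : ¬ q ∈₂ E j → p ∈₂ E j
      p∈Ej q∉Ej = decidable-stable (p ∈₂? E j) λ p∉Ej → q∉Ej (end-of-f pj p∉Ej)
      triangle : ¬ q ∈₂ E j → Meets (E j) (E k) → ⊥
      triangle q∉Ej (e , e∈Ej , e∈Ek) = triangle-free p q e (edge pf)
        (adjacent-in-edge (edge pk) q∈Ek e∈Ek λ { refl → q∉Ej e∈Ej })
        (adjacent-in-edge (edge pj) (p∈Ej q∉Ej) e∈Ej λ { refl → p∉Ek e∈Ek })

-- The construction

module Positions (H : WGraph) (enum : Fin (WGraph.n H) → List (Fin (WGraph.n H)))
                 (match : Fin (WGraph.n H) → Fin (WGraph.n H) → ℕ × ℕ → ℕ × ℕ) where
  open WGraph H
  open Construction H enum match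

  even-position : ∀ {u} c L → p u ≡ 2 * ℓ u → c * p u + 2 * L ≡ 2 * (c * ℓ u + L)
  even-position {u} c L p≡ = begin
    c * p u + 2 * L         ≡⟨ cong (λ z → c * z + 2 * L) p≡ ⟩
    c * (2 * ℓ u) + 2 * L   ≡⟨ cong (_+ 2 * L) (*-assoc c 2 (ℓ u)) ⟨
    c * 2 * ℓ u + 2 * L     ≡⟨ cong (λ z → z * ℓ u + 2 * L) (*-comm c 2) ⟩
    2 * c * ℓ u + 2 * L     ≡⟨ cong (_+ 2 * L) (*-assoc 2 c (ℓ u)) ⟩
    2 * (c * ℓ u) + 2 * L   ≡⟨ *-distribˡ-+ 2 (c * ℓ u) L ⟨
    2 * (c * ℓ u + L)       ∎
    where open ≡-Reasoning

  -- Copies of vertices of L sit at even positions, so InNCopies relates only copies of one vertex.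
  ¬inNCopies-even : ∀ {u c L L′} → p u ≡ 2 * ℓ u → 2 * L < p u → 2 * L′ < p u → L ≢ L′ →
    ¬ InNCopies u (2 * L′) (c * p u + 2 * L)
  ¬inNCopies-even {c = c} {L} {L′} p≡ 2L< 2L′< L≢L′ (c′ , _ , inj₁ same) =
    L≢L′ (*-cancelˡ-≡ L L′ 2 (proj₂ (*+-injective c c′ 2L< 2L′< same)))
  ¬inNCopies-even {c = c} {L} {L′} p≡ _ _ _ (c′ , _ , inj₂ (inj₁ odd≡even)) =
    even≢odd (c′ * ℓ _ + L′) (c * ℓ _ + L)
      (trans (sym (even-position c′ L′ p≡)) (trans (sym odd≡even) (cong suc (even-position c L p≡))))
  ¬inNCopies-even {c = c} {L} {L′} p≡ _ _ _ (c′ , _ , inj₂ (inj₂ even≡odd)) =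
    even≢odd (c * ℓ _ + L) (c′ * ℓ _ + L′)
      (trans (sym (even-position c L p≡)) (trans even≡odd (cong suc (even-position c′ L′ p≡))))

  inversion⇒gadgetEdge : ∀ {u c₁ c₂ L₁ L₂} → p u ≡ 2 * ℓ u → 2 * L₁ < p u → 2 * L₂ < p u → L₂ < L₁ →
    c₁ * p u + 2 * L₁ < c₂ * p u + 2 * L₂ → GadgetEdge u (c₁ * p u + 2 * L₁) (c₂ * p u + 2 * L₂)
  inversion⇒gadgetEdge {u} {c₁} {c₂} {L₁} {L₂} p≡ 2L₁< 2L₂< L₂<L₁ q₁<q₂ =
    inj₂ (different-copies , ¬near₁ , ¬near₂)
    where
    different-copies : (c₁ * p u + 2 * L₁) / p u ≢ (c₂ * p u + 2 * L₂) / p u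
    different-copies eq with trans (sym ([m*n+o]/n≡m c₁ 2L₁<)) (trans eq ([m*n+o]/n≡m c₂ 2L₂<))
    ... | refl = <-asym L₂<L₁ (*-cancelˡ-< 2 L₁ L₂ (+-cancelˡ-< (c₁ * p u) (2 * L₁) (2 * L₂) q₁<q₂))
    ¬near₁ : ¬ InNCopies u ((c₁ * p u + 2 * L₁) % p u) (c₂ * p u + 2 * L₂)
    ¬near₁ rewrite [m*n+o]%n≡o c₁ 2L₁< = ¬inNCopies-even {c = c₂} p≡ 2L₂< 2L₁< (<⇒≢ L₂<L₁)
    ¬near₂ : ¬ InNCopies u ((c₂ * p u + 2 * L₂) % p u) (c₁ * p u + 2 * L₁)
    ¬near₂ rewrite [m*n+o]%n≡o c₂ 2L₂< = ¬inNCopies-even {c = c₁} p≡ 2L₁< 2L₂< (≢-sym (<⇒≢ L₂<L₁))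

  inNCopies⇒near : ∀ {u s q} → s < p u → InNCopies u s q → CyclicNear (p u) s (q % p u)
  inNCopies⇒near {u} {s} {q} s<p (c , _ , inj₁ refl) = zero , [m*n+o]%n≡o c s<p
  inNCopies⇒near {u} {s} {q} s<p (c , _ , inj₂ (inj₁ q+1≡)) = suc (suc zero) , (begin
    s                       ≡⟨ [m*n+o]%n≡o c s<p ⟨
    (c * p u + s) % p u     ≡⟨ cong (_% p u) q+1≡ ⟨
    suc q % p u             ≡⟨ [1+m%n]%n≡[1+m]%n q (p u) ⟨
    suc (q % p u) % p u     ∎)
    where open ≡-Reasoning
  inNCopies⇒near {u} {s} {q} s<p (c , _ , inj₂ (inj₂ refl)) = suc zero , (begin
    suc (c * p u + s) % p u ≡⟨ cong (λ z → suc z % p u) (+-comm (c * p u) s) ⟩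
    (suc s + c * p u) % p u ≡⟨ [m+kn]%n≡m%n (suc s) c (p u) ⟩
    suc s % p u             ∎)
    where open ≡-Reasoning

  pre+f≤sum : ∀ (l : List (Fin n)) f {v} → v ∈ l → pre l f v + f v ≤ sum (map f l)
  pre+f≤sum (w ∷ ws) f {v} v∈ with w ≟ᶠ v | v∈
  ... | yes refl | _          = m≤m+n (f w) _
  ... | no w≢v   | here refl  = contradiction refl w≢v
  ... | no _     | there v∈ws = begin
    f w + pre ws f v + f v     ≡⟨ +-assoc (f w) _ (f v) ⟩
    f w + (pre ws f v + f v)   ≤⟨ +-monoʳ-≤ (f w) (pre+f≤sum ws f v∈ws) ⟩
    f w + sum (map f ws)       ∎
    where open ≤-Reasoning

  module _ (enum-ok : EnumOK H enum) where

    offset<D : ∀ {z} → ValidG z → pre (enum (gu z)) (m H (gu z)) (gv' z) + gk z < D (gu z)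
    offset<D {z} (uv , _ , k<m) = <-≤-trans (+-monoʳ-< _ k<m)
      (pre+f≤sum (enum (gu z)) (m H (gu z)) (proj₂ (proj₂ (enum-ok (gu z)) (gv' z)) uv))

    Lpos<next-layer : ∀ {z} → ValidG z → Lpos z < suc (gi z) * D (gu z)
    Lpos<next-layer {z} valid = begin-strict
      Lpos z                                                            ≡⟨ +-assoc (gi z * D (gu z)) _ (gk z) ⟩
      gi z * D (gu z) + (pre (enum (gu z)) (m H (gu z)) (gv' z) + gk z) <⟨ +-monoʳ-< _ (offset<D valid) ⟩
      gi z * D (gu z) + D (gu z)                                        ≡⟨ +-comm (gi z * D (gu z)) _ ⟩
      suc (gi z) * D (gu z)                                             ∎
      where open ≤-Reasoning

    Lpos<ℓ : ∀ {z} → ValidG z → Lpos z < ℓ (gu z)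
    Lpos<ℓ {z} valid = <-≤-trans (Lpos<next-layer valid) (*-monoˡ-≤ (D (gu z)) (proj₁ (proj₂ valid)))

    p≡2ℓ : ∀ {z} → ValidG z → p (gu z) ≡ 2 * ℓ (gu z)
    p≡2ℓ {z} valid = m+[n∸m]≡n (≤-trans (<-≤-trans (s≤s z≤n) (Lpos<ℓ valid)) (m≤m+n _ _))

    Ppos<p : ∀ {z} → ValidG z → Ppos z < p (gu z)
    Ppos<p {z} valid = subst (Ppos z <_) (sym (p≡2ℓ valid)) (*-monoʳ-< 2 (Lpos<ℓ valid))

    layer-<⇒Lpos-< : ∀ {x y} → ValidG y → gu x ≡ gu y → gi y < gi x → Lpos y < Lpos x
    layer-<⇒Lpos-< {x} {y} valid refl gy<gx = begin-strict
      Lpos y                                                   <⟨ Lpos<next-layer valid ⟩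
      suc (gi y) * D (gu y)                                    ≤⟨ *-monoˡ-≤ (D (gu y)) gy<gx ⟩
      gi x * D (gu x)                                          ≤⟨ m≤m+n _ _ ⟩
      gi x * D (gu x) + pre (enum (gu x)) (m H (gu x)) (gv' x) ≤⟨ m≤m+n _ _ ⟩
      Lpos x                                                   ∎
      where open ≤-Reasoning

    inversion-copies⇒gadgetEdge : ∀ {s t x y} → ValidG x → ValidG y → IsCopy s x → IsCopy t y →
      gu x ≡ gu y → gi y < gi x → sq s < sq t → su s ≡ su t × GadgetEdge (su s) (sq s) (sq t)
    inversion-copies⇒gadgetEdge {sv _ _} {sv _ _} {gv _ _ _ _} {gv _ _ _ _}
      vx vy (refl , c₁ , _ , refl) (refl , c₂ , _ , refl) refl gy<gx q<q′ =
      refl , inversion⇒gadgetEdge {c₁ = c₁} {c₂} (p≡2ℓ vx) (Ppos<p vx) (Ppos<p vy)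
               (layer-<⇒Lpos-< vy refl gy<gx) q<q′

module EdgesOfGStar (H : WGraph) (enum : Fin (WGraph.n H) → List (Fin (WGraph.n H)))
                    (match : Fin (WGraph.n H) → Fin (WGraph.n H) → ℕ × ℕ → ℕ × ℕ) where
  open WGraph H
  open Construction H enum match
  open Pairs (_≟ᶠ_ {n})

  valid-ends-distinct : ∀ {x} → ValidG x → gu x ≢ gv' x
  valid-ends-distinct {x} (uv , _) same =
    contradiction (trans (sym (subst (λ v → adj (gu x) v ≡ true) (sym same) uv)) (adj-irrefl (gu x))) λ ()

  ¬meets⇒disjoint : ∀ {u v x y} → ¬ Meets (u , v) (x , y) → DisjointEnds u v x y
  ¬meets⇒disjoint ¬meets =
    (λ u≡x → ¬meets (_ , inj₁ refl , inj₁ u≡x)) , (λ u≡y → ¬meets (_ , inj₁ refl , inj₂ u≡y)) ,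
    (λ v≡x → ¬meets (_ , inj₂ refl , inj₁ v≡x)) , (λ v≡y → ¬meets (_ , inj₂ refl , inj₂ v≡y))

  disjoint⇒¬meets : ∀ {u v x y} → DisjointEnds u v x y → ¬ Meets (u , v) (x , y)
  disjoint⇒¬meets (u≢x , _ , _ , _) (_ , inj₁ refl , inj₁ e≡x) = u≢x e≡x
  disjoint⇒¬meets (_ , u≢y , _ , _) (_ , inj₁ refl , inj₂ e≡y) = u≢y e≡y
  disjoint⇒¬meets (_ , _ , v≢x , _) (_ , inj₂ refl , inj₁ e≡x) = v≢x e≡x
  disjoint⇒¬meets (_ , _ , _ , v≢y) (_ , inj₂ refl , inj₂ e≡y) = v≢y e≡y

  IsGadgetEdge : ∀ {s t} → EdgeS s t → Set
  IsGadgetEdge (_ , _ , inj₁ _) = ⊤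
  IsGadgetEdge (_ , _ , inj₂ _) = ⊥

  isGadgetEdge? : ∀ {s t} (e : EdgeS s t) → Dec (IsGadgetEdge e)
  isGadgetEdge? (_ , _ , inj₁ _) = yes tt
  isGadgetEdge? (_ , _ , inj₂ _) = no λ ()

  gadgetEdge-data : ∀ {s t} (e : EdgeS s t) → IsGadgetEdge e → su s ≡ su t × GadgetEdge (su s) (sq s) (sq t)
  gadgetEdge-data (_ , _ , inj₁ g) _ = g

  -- junk for gadget edges, which are not lifted from edges of G
  lowerₛ lowerₜ : ∀ {s t} → EdgeS s t → GV n
  lowerₛ {s} (_ , _ , inj₁ _)           = gv (su s) (su s) 0 0
  lowerₛ     (_ , _ , inj₂ (x , _))     = x
  lowerₜ {s} (_ , _ , inj₁ _)           = gv (su s) (su s) 0 0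
  lowerₜ     (_ , _ , inj₂ (_ , y , _)) = y

  liftedEdge-data : ∀ {s t} (e : EdgeS s t) → ¬ IsGadgetEdge e →
    EdgeG (lowerₛ e) (lowerₜ e) × IsCopy s (lowerₛ e) × IsCopy t (lowerₜ e)
  liftedEdge-data (_ , _ , inj₁ _) ¬gadget = contradiction tt ¬gadget
  liftedEdge-data (_ , _ , inj₂ (_ , _ , exy , cx , cy)) _ = exy , cx , cy

-- The layout

allPairs-take-drop : ∀ {A : Set} {R : Rel A 0ℓ} j {xs x y} →
  AllPairs R xs → x ∈ take j xs → y ∈ drop j xs → R x y
allPairs-take-drop (suc j) {_ ∷ xs} (Rx ∷ _)   (here refl) y∈ = All.lookup Rx (drop⊆ j y∈)
  where
  drop⊆ : ∀ j {xs y} → y ∈ drop j xs → y ∈ xs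
  drop⊆ 0 y∈ = y∈
  drop⊆ (suc j) {_ ∷ _} y∈ = there (drop⊆ j y∈)
allPairs-take-drop (suc j) {_ ∷ xs} (_ ∷ Rxs) (there x∈) y∈ = allPairs-take-drop j Rxs x∈ y∈

module Layout (H : WGraph) (enum : Fin (WGraph.n H) → List (Fin (WGraph.n H)))
              (match : Fin (WGraph.n H) → Fin (WGraph.n H) → ℕ × ℕ → ℕ × ℕ)
              {_≺_ : Rel (Fin (WGraph.n H)) 0ℓ} (sto : IsStrictTotalOrder _≡_ _≺_) where
  open WGraph H
  open Construction H enum match
  open IsStrictTotalOrder sto using () renaming (irrefl to ≺-irrefl)

  infix 4 _⊏_
  _⊏_ : Rel (SV n) 0ℓ
  s ⊏ t = su s ≺ su t ⊎ (su s ≡ su t × sq s < sq t)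

  ⊏⇒≢ : ∀ {s t} → s ⊏ t → s ≢ t
  ⊏⇒≢ (inj₁ u≺u)      refl = ≺-irrefl refl u≺u
  ⊏⇒≢ (inj₂ (_ , q<q)) refl = <-irrefl refl q<q

  private
    ≼-order : DecTotalOrder 0ℓ 0ℓ 0ℓ
    ≼-order = record { isDecTotalOrder = StrictToNonStrict.isDecTotalOrder _≡_ _≺_ sto }
  open Data.List.Sort ≼-order using (sort; sort-↭; sort-↗)

  vertices : List (Fin n)
  vertices = sort (allFin n)

  ∈-vertices : ∀ u → u ∈ vertices
  ∈-vertices u = ∈-resp-↭ (↭-sym (sort-↭ (allFin n))) (∈-allFin u)

  vertices-increasing : AllPairs _≺_ vertices
  vertices-increasing = AllPairs.zipWith strict
    (Sorted⇒AllPairs (DecTotalOrder.totalOrder ≼-order) (sort-↗ (allFin n)) , distinct)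
    where
    distinct : Unique vertices
    distinct = Unique-resp-↭ (setoid (Fin n)) (↭⇒↭ₛ (↭-sym (sort-↭ (allFin n)))) (allFin⁺ n)
    strict : ∀ {u v} → (u ≺ v ⊎ u ≡ v) × u ≢ v → u ≺ v
    strict (inj₁ u≺v , _)   = u≺v
    strict (inj₂ u≡v , u≢v) = contradiction u≡v u≢v

  -- Opaque because b is about 7.9·10⁶: unfolding upTo (b * p u) exhausts the type checker.
  opaque
    blockSize : Fin n → ℕ
    blockSize u = b * p u

    blockSize≡ : ∀ u → blockSize u ≡ b * p u
    blockSize≡ u = refl

  block : Fin n → List (SV n)
  block u = map (sv u) (upTo (blockSize u))

  ∈-block⁻ : ∀ {u s} → s ∈ block u → su s ≡ u × ValidS s
  ∈-block⁻ {u} s∈ = from (∈-map⁻ (sv u) s∈)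
    where
    from : ∀ {s} → ∃ (λ q → q ∈ upTo (blockSize u) × s ≡ sv u q) → su s ≡ u × ValidS s
    from (q , q∈ , refl) = refl , subst (q <_) (blockSize≡ u) (∈-upTo⁻ q∈)

  infix 4 _⋘_
  _⋘_ : Rel (List (SV n)) 0ℓ
  ss ⋘ ts = All.All (λ s → All.All (s ⊏_) ts) ss

  block-increasing : ∀ u → AllPairs _⊏_ (block u)
  block-increasing u = AllPairsₚ.map⁺ (AllPairsₚ.applyUpTo⁺₁ id (blockSize u) λ i<j _ → inj₂ (refl , i<j))

  blocks-increasing : ∀ {u v} → u ≺ v → block u ⋘ block v
  blocks-increasing u≺v = All.tabulate λ s∈ → All.tabulate λ t∈ →
    inj₁ (subst₂ _≺_ (sym (proj₁ (∈-block⁻ s∈))) (sym (proj₁ (∈-block⁻ t∈))) u≺v)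

  layout : List (SV n)
  layout = concatMap block vertices

  layout-increasing : AllPairs _⊏_ layout
  layout-increasing = AllPairsₚ.concat⁺
    (Allₚ.map⁺ (All.universal block-increasing vertices))
    (AllPairsₚ.map⁺ {R = _⋘_} (AllPairs.map blocks-increasing vertices-increasing))

  layout-linear : LinearLayout layout
  layout-linear = AllPairs.map ⊏⇒≢ layout-increasing , λ s → ∈layout⇒valid , valid⇒∈layout
    where
    ∈layout⇒valid : ∀ {s} → s ∈ layout → ValidS s
    ∈layout⇒valid s∈ =
      proj₂ (∈-block⁻ (proj₂ (Any.satisfied (∈-concatMap⁻ block {xs = vertices} s∈))))
    valid⇒∈layout : ∀ {s} → ValidS s → s ∈ layout
    valid⇒∈layout {sv u q} q< =
      ∈-concatMap⁺ block (lose (∈-vertices u)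
        (∈-map⁺ (sv u) (∈-upTo⁺ (subst (q <_) (sym (blockSize≡ u)) q<))))

does-transfer : ∀ {A B : Set} (a? : Dec A) (b? : Dec B) → does a? ≡ does b? → A → B
does-transfer (yes _) (yes b) _  _ = b
does-transfer (no ¬a) _       _  a = contradiction a ¬a
does-transfer (yes _) (no _)  () _

gv-≡ : ∀ {k} {x y : GV k} → gu x ≡ gu y → gv' x ≡ gv' y → gi x ≡ gi y → gk x ≡ gk y → x ≡ y
gv-≡ {x = gv _ _ _ _} {gv _ _ _ _} refl refl refl refl = refl

-- Cuts of the layout

module Cut (H : WGraph) (enum : Fin (WGraph.n H) → List (Fin (WGraph.n H)))
           (match : Fin (WGraph.n H) → Fin (WGraph.n H) → ℕ × ℕ → ℕ × ℕ)
           {_≺_ : Rel (Fin (WGraph.n H)) 0ℓ} (sto : IsStrictTotalOrder _≡_ _≺_)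
           (triangle-free : TriangleFree H) (enum-ok : EnumOK H enum) (balanced : Balancing H τ _≺_ sto)
           {r : ℕ} (xs ys : Fin r → SV (WGraph.n H))
           (before : ∀ i j → Layout._⊏_ H enum match sto (xs i) (ys j))
           (edge : ∀ i → Construction.EdgeS H enum match (xs i) (ys i))
           (induced : ∀ i j → i ≢ j → ¬ Construction.EdgeS H enum match (xs i) (ys j)) where
  open WGraph H
  open Construction H enum match
  open Positions H enum match
  open EdgesOfGStar H enum match
  open Layout H enum match sto using (_⊏_)
  open Pairs (_≟ᶠ_ {n})
  open IsStrictTotalOrder sto using () renaming (_<?_ to _≺?_; irrefl to ≺-irrefl; asym to ≺-asym)

  open InducedMatching EdgeS xs ys induced using (edge⇒≡)

  gadget-edge⇒≡ : ∀ {i j} → su (xs i) ≡ su (ys j) →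
    GadgetEdge (su (xs i)) (sq (xs i)) (sq (ys j)) → i ≡ j
  gadget-edge⇒≡ {i} {j} same g = edge⇒≡ (proj₁ (edge i) , proj₁ (proj₂ (edge j)) , inj₁ (same , g))

  lifted-edge⇒≡ : ∀ {i j x y} → IsCopy (xs i) x → IsCopy (ys j) y → EdgeG x y → i ≡ j
  lifted-edge⇒≡ {i} {j} {x} {y} cx cy exy =
    edge⇒≡ (proj₁ (edge i) , proj₁ (proj₂ (edge j)) , inj₂ (x , y , exy , cx , cy))

  same-block-< : ∀ {i j} → su (xs i) ≡ su (ys j) → sq (xs i) < sq (ys j)
  same-block-< {i} {j} same =
    [ (λ u≺u → contradiction (subst (su (xs i) ≺_) (sym same) u≺u) (≺-irrefl refl)) , proj₂ ]′ (before i j)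

  Gadget : Pred (Fin r) 0ℓ
  Gadget i = IsGadgetEdge (edge i)

  gadget? : Decidable Gadget
  gadget? i = isGadgetEdge? (edge i)

  gadget-data : ∀ {i} → Gadget i → su (xs i) ≡ su (ys i) × GadgetEdge (su (xs i)) (sq (xs i)) (sq (ys i))
  gadget-data {i} = gadgetEdge-data (edge i)

  gadgets-same-block : ∀ {i j} → Gadget i → Gadget j → su (xs i) ≡ su (xs j)
  gadgets-same-block {i} {j} gi gj = compare (before i j) (before j i)
    where
    compare : xs i ⊏ ys j → xs j ⊏ ys i → su (xs i) ≡ su (xs j)
    compare (inj₂ (same , _)) _                 = trans same (sym (proj₁ (gadget-data gj)))
    compare _                 (inj₂ (same , _)) = sym (trans same (sym (proj₁ (gadget-data gi))))
    compare (inj₁ i≺j)        (inj₁ j≺i)        = contradiction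
      (subst (su (xs j) ≺_) (sym (proj₁ (gadget-data gi))) j≺i)
      (≺-asym (subst (su (xs i) ≺_) (sym (proj₁ (gadget-data gj))) i≺j))

  module OneGadget (W : Fin n) (in-W : ∀ {i} → Gadget i → su (xs i) ≡ W) where
    -- q: a position on Q_W; c = q / p W: the index of the copy of P_W containing it;
    -- s = q % p W: the position inside that copy.
    qx qy cx cy sx sy : Fin r → ℕ
    qx i = sq (xs i)
    qy i = sq (ys i)
    cx i = qx i / p W
    cy i = qy i / p W
    sx i = qx i % p W
    sy i = qy i % p W

    CrossEdge : ℕ → ℕ → Set
    CrossEdge q q′ = q / p W ≢ q′ / p W × ¬ InNCopies W (q % p W) q′ × ¬ InNCopies W (q′ % p W) q

    in-W′ : ∀ {i} → Gadget i → su (ys i) ≡ W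
    in-W′ gi = trans (sym (proj₁ (gadget-data gi))) (in-W gi)

    gadget-edge : ∀ {i} → Gadget i → GadgetEdge W (qx i) (qy i)
    gadget-edge {i} gi = subst (λ u → GadgetEdge u (qx i) (qy i)) (in-W gi) (proj₂ (gadget-data gi))

    qx<qy : ∀ {i j} → Gadget i → su (ys j) ≡ W → qx i < qy j
    qx<qy gi in-W-j = same-block-< (trans (in-W gi) (sym in-W-j))

    gadget-edge-between : ∀ {i j} → Gadget i → Gadget j → GadgetEdge W (qx i) (qy j) → i ≡ j
    gadget-edge-between {i} {j} gi gj g = gadget-edge⇒≡ (trans (in-W gi) (sym (in-W′ gj)))
      (subst (λ u → GadgetEdge u (qx i) (qy j)) (sym (in-W gi)) g)

    Path Cross : Pred (Fin r) 0ℓ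
    Path  i = Gadget i × suc (qx i) ≡ qy i
    Cross i = Gadget i × suc (qx i) ≢ qy i

    cross-edge : ∀ {i} → Cross i → CrossEdge (qx i) (qy i)
    cross-edge {i} (gi , ¬path) = from (gadget-edge gi)
      where
      from : GadgetEdge W (qx i) (qy i) → CrossEdge (qx i) (qy i)
      from (inj₁ (inj₁ path))     = contradiction path ¬path
      from (inj₁ (inj₂ backward)) =
        contradiction (subst (qy i <_) backward (n<1+n (qy i))) (<-asym (qx<qy gi (in-W′ gi)))
      from (inj₂ cross)           = cross

    path-bound : AtMost Path 1
    path-bound = atMost-subsingleton λ {i} {j} (gi , pi) (gj , pj) →
      let qx≤qx′ = s≤s⁻¹ (subst (qx i <_) (sym pj) (qx<qy gi (in-W′ gj)))
          qx′≤qx = s≤s⁻¹ (subst (qx j <_) (sym pi) (qx<qy gj (in-W′ gi)))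
          xs≡xs  = cong₂ sv (trans (in-W gi) (sym (in-W gj))) (≤-antisym qx≤qx′ qx′≤qx)
      in edge⇒≡ (subst (λ s → EdgeS s (ys j)) (sym xs≡xs) (edge j))

    -- All cx lie below all cy, so within a class of the split by Reaches no cx i equals a cy j.
    Reaches : Pred (Fin r) 0ℓ
    Reaches i = ∃ λ j → su (ys j) ≡ W × cy j ≡ cx i

    reaches? : Decidable Reaches
    reaches? i = any? λ j → (su (ys j) ≟ᶠ W) ×-dec (cy j ≟ cx i)

    Class : Bool → Pred (Fin r) 0ℓ
    Class b i = Cross i × does (reaches? i) ≡ b

    class-separated : ∀ {b i j} → Class b i → Class b j → cx i ≢ cy j
    class-separated {b} {i} {j} (ci , ri) (cj , rj) cxi≡cyj =
      proj₁ (cross-edge cj) (≤-antisym (/-monoˡ-≤ (p W) (<⇒≤ (qx<qy (proj₁ cj) (in-W′ (proj₁ cj))))) cy≤cx)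
      where
      reaches-j : Reaches j
      reaches-j = does-transfer (reaches? i) (reaches? j) (trans ri (sym rj))
                    (j , in-W′ (proj₁ cj) , sym cxi≡cyj)
      cy≤cx : cy j ≤ cx j
      cy≤cx = let (k , in-W-k , cyk≡cxj) = reaches-j in subst (_≤ cx j) cxi≡cyj
        (subst (cx i ≤_) cyk≡cxj (/-monoˡ-≤ (p W) (<⇒≤ (qx<qy (proj₁ ci) in-W-k))))

    near-of-nonadjacent : ∀ {b i j} → Class b i → Class b j → i ≢ j → CyclicNear (p W) (sx i) (sy j)
    near-of-nonadjacent {i = i} {j} ci cj i≢j = decidable-stable (cyclicNear? (p W) (sx i) (sy j)) λ ¬near →
      i≢j (gadget-edge-between (proj₁ (proj₁ ci)) (proj₁ (proj₁ cj)) (inj₂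
        ( class-separated ci cj
        , (λ near → ¬near (inNCopies⇒near (m%n<n (qx i) (p W)) near))
        , (λ near → ¬near (cyclicNear-sym (p W) (inNCopies⇒near (m%n<n (qy j) (p W)) near))))))

    same-residues⇒≡ : ∀ {b i j} → Class b i → Class b j → sx i ≡ sx j → sy i ≡ sy j → i ≡ j
    same-residues⇒≡ {i = i} {j} ci cj sx≡ sy≡ =
      gadget-edge-between (proj₁ (proj₁ ci)) (proj₁ (proj₁ cj)) (inj₂
      ( class-separated ci cj
      , subst (λ s → ¬ InNCopies W s (qy j)) (sym sx≡) (proj₁ (proj₂ (cross-edge (proj₁ cj))))
      , subst (λ s → ¬ InNCopies W s (qx i)) sy≡ (proj₂ (proj₂ (cross-edge (proj₁ ci))))))

    -- Relative to a fixed member f, the residues of every other member of a class are cyclic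
    -- neighbours of those of f: 3 × 3 possibilities, each taken at most once.
    class-bound : ∀ b → AtMost (Class b) 10
    class-bound b = atMost-inhabited class? λ {f} cf → atMost-insert f
      (atMost-partition _≟ᶠ_ (λ i → nearTag (p W) (sx f) (sy i)) (allFin 3) _ (λ _ → ∈-allFin _) λ _ →
        atMost-partition _≟ᶠ_ (λ i → nearTag (p W) (sy f) (sx i)) (allFin 3) _ (λ _ → ∈-allFin _) λ _ →
          atMost-subsingleton λ {i} {j} (((ci , i≢f) , tag-i) , tag′-i) (((cj , j≢f) , tag-j) , tag′-j) →
            same-residues⇒≡ ci cj
              (nearTag-injective (p W) (m%n<n (qx i) (p W)) (m%n<n (qx j) (p W))
                 (to-f cf ci i≢f) (to-f cf cj j≢f) (trans tag′-i (sym tag′-j)))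
              (nearTag-injective (p W) (m%n<n (qy i) (p W)) (m%n<n (qy j) (p W))
                 (from-f cf ci i≢f) (from-f cf cj j≢f) (trans tag-i (sym tag-j))))
      where
      class? : Decidable (Class b)
      class? i = ((gadget? i) ×-dec ¬? (suc (qx i) ≟ qy i)) ×-dec (does (reaches? i) Bool.≟ b)
      from-f : ∀ {f i} → Class b f → Class b i → i ≢ f → CyclicNear (p W) (sx f) (sy i)
      from-f cf ci i≢f = near-of-nonadjacent cf ci (≢-sym i≢f)
      to-f : ∀ {f i} → Class b f → Class b i → i ≢ f → CyclicNear (p W) (sy f) (sx i)
      to-f cf ci i≢f = cyclicNear-sym (p W) (near-of-nonadjacent ci cf i≢f)

    gadget-bound-in-W : AtMost Gadget 21
    gadget-bound-in-W = atMost-split (λ i → suc (qx i) ≟ qy i) path-bound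
      (atMost-partition Bool._≟_ (λ i → does (reaches? i)) (true ∷ false ∷ []) (λ _ → 10)
        (λ {i} _ → both (does (reaches? i))) class-bound)
      where
      both : ∀ b → b ∈ true ∷ false ∷ []
      both true  = here refl
      both false = there (here refl)

  gadget-bound : AtMost Gadget 21
  gadget-bound = atMost-inhabited gadget? λ gf → OneGadget.gadget-bound-in-W _ λ gi → gadgets-same-block gi gf

  Lifted : Pred (Fin r) 0ℓ
  Lifted = ∁ Gadget

  -- For a lifted edge, xs i and ys i are copies of x̂ i and ŷ i, with end pairs X i and Y i in H.
  x̂ ŷ : Fin r → GV n
  x̂ i = lowerₛ (edge i)
  ŷ i = lowerₜ (edge i)

  X Y : Fin r → Fin n × Fin n
  X i = gu (x̂ i) , gv' (x̂ i)
  Y i = gu (ŷ i) , gv' (ŷ i)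

  lifted-edgeG : ∀ {i} → Lifted i → EdgeG (x̂ i) (ŷ i)
  lifted-edgeG {i} li = proj₁ (liftedEdge-data (edge i) li)

  lifted-copyₛ : ∀ {i} → Lifted i → IsCopy (xs i) (x̂ i)
  lifted-copyₛ {i} li = proj₁ (proj₂ (liftedEdge-data (edge i) li))

  lifted-copyₜ : ∀ {i} → Lifted i → IsCopy (ys i) (ŷ i)
  lifted-copyₜ {i} li = proj₂ (proj₂ (liftedEdge-data (edge i) li))

  lifted-meet : ∀ {i j} → Lifted i → Lifted j → i ≢ j → Meets (X i) (Y j)
  lifted-meet li lj i≢j = decidable-stable (meets? _ _) λ ¬meets →
    i≢j (lifted-edge⇒≡ (lifted-copyₛ li) (lifted-copyₜ lj)
      (proj₁ (lifted-edgeG li) , proj₁ (proj₂ (lifted-edgeG lj)) , inj₁ (¬meets⇒disjoint ¬meets)))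

  Dummy : Pred (Fin r) 0ℓ
  Dummy i = Lifted i × ¬ Meets (X i) (Y i)

  dummy? : Decidable Dummy
  dummy? i = ¬? (gadget? i) ×-dec ¬? (meets? (X i) (Y i))

  -- Relative to a fixed dummy edge f, a class records which end of Y f lies in X j and which end
  -- of X f lies in Y j.
  dummy-bound : AtMost Dummy 9
  dummy-bound = atMost-inhabited dummy? λ {f} df → atMost-insert f
    (atMost-partition _≟ᶠ_ (λ j → pick (X j) (Y f)) _ _ (λ {j} _ → pick-∈ (X j) (Y f)) λ α →
      atMost-partition _≟ᶠ_ (λ j → pick (Y j) (X f)) _ _ (λ {j} _ → pick-∈ (Y j) (X f)) λ β →
        atMost-crossing (class? f α β) (λ j → other (X j) α) (λ k → other (Y k) β)
          (crossing f α β df) diagonal)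
    where
    Class : Fin r → Fin n → Fin n → Pred (Fin r) 0ℓ
    Class f α β = ((Dummy ∩ (_≢ f)) ∩ (λ j → pick (X j) (Y f) ≡ α)) ∩ (λ j → pick (Y j) (X f) ≡ β)
    class? : ∀ f α β → Decidable (Class f α β)
    class? f α β =
      ((dummy? ∩? λ j → ¬? (j ≟ᶠ f)) ∩? λ j → pick (X j) (Y f) ≟ᶠ α) ∩? λ j → pick (Y j) (X f) ≟ᶠ β
    α∈X : ∀ {f α β j} → Dummy f → Class f α β j → α ∈₂ X j
    α∈X {f} df (((dj , j≢f) , refl) , _) = pick-∈₂ (lifted-meet (proj₁ dj) (proj₁ df) j≢f)
    β∈Y : ∀ {f α β j} → Dummy f → Class f α β j → β ∈₂ Y j
    β∈Y {f} df (((dj , j≢f) , _) , refl) =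
      pick-∈₂ (meets-sym (lifted-meet (proj₁ df) (proj₁ dj) (≢-sym j≢f)))
    crossing : ∀ f α β → Dummy f → ∀ {j k} → Class f α β j → Class f α β k → j ≢ k →
      other (X j) α ≡ other (Y k) β
    crossing f α β df cj ck j≢k = crossing-others (α∈X df cj) (α∈X df ck) (β∈Y df cj) (β∈Y df ck)
      (proj₂ (proj₁ (proj₁ (proj₁ cj)))) (proj₂ (proj₁ (proj₁ (proj₁ ck))))
      (lifted-meet (proj₁ (proj₁ (proj₁ (proj₁ cj)))) (proj₁ (proj₁ (proj₁ (proj₁ ck)))) j≢k)
    diagonal : ∀ {f α β j} → Class f α β j → other (X j) α ≢ other (Y j) β
    diagonal {α = α} {β} {j} cj eq =
      proj₂ (proj₁ (proj₁ (proj₁ cj)))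
        (other (X j) α , other-∈₂ (X j) α , subst (_∈₂ Y j) (sym eq) (other-∈₂ (Y j) β))

  Matching : Pred (Fin r) 0ℓ
  Matching i = Lifted i × Meets (X i) (Y i)

  matching? : Decidable Matching
  matching? i = ¬? (gadget? i) ×-dec meets? (X i) (Y i)

  matching-valid : ∀ {i} → Matching i → ValidG (x̂ i) × ValidG (ŷ i)
  matching-valid (li , _) = proj₁ (lifted-edgeG li) , proj₁ (proj₂ (lifted-edgeG li))

  matching-swap : ∀ {i} → Matching i → gu (ŷ i) ≡ gv' (x̂ i) × gv' (ŷ i) ≡ gu (x̂ i)
  matching-swap {i} (li , meets) = from (proj₂ (proj₂ (lifted-edgeG li)))
    where
    from : DisjointEnds (gu (x̂ i)) (gv' (x̂ i)) (gu (ŷ i)) (gv' (ŷ i)) ⊎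
           MatchEdge (x̂ i) (ŷ i) ⊎ MatchEdge (ŷ i) (x̂ i) →
      gu (ŷ i) ≡ gv' (x̂ i) × gv' (ŷ i) ≡ gu (x̂ i)
    from (inj₁ disjoint)             = contradiction meets (disjoint⇒¬meets disjoint)
    from (inj₂ (inj₁ (e₁ , e₂ , _))) = e₁ , e₂
    from (inj₂ (inj₂ (e₁ , e₂ , _))) = sym e₂ , sym e₁

  matching-meets : ∀ {i j} → Matching i → Matching j → Meets (X i) (X j)
  matching-meets {i} {j} mi mj = from (i ≟ᶠ j)
    where
    Y⊆X : ∀ {e} → e ∈₂ Y j → e ∈₂ X j
    Y⊆X (inj₁ e≡) = inj₂ (trans e≡ (proj₁ (matching-swap mj)))
    Y⊆X (inj₂ e≡) = inj₁ (trans e≡ (proj₂ (matching-swap mj)))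
    from : Dec (i ≡ j) → Meets (X i) (X j)
    from (yes i≡j) = subst (λ k → Meets (X i) (X k)) i≡j (gu (x̂ i) , inj₁ refl , inj₁ refl)
    from (no i≢j)  = let (e , e∈Xi , e∈Yj) = lifted-meet (proj₁ mi) (proj₁ mj) i≢j in e , e∈Xi , Y⊆X e∈Yj

  matching-order : ∀ {i} → Matching i → gu (x̂ i) ≺ gv' (x̂ i)
  matching-order {i} mi = from (before i i)
    where
    su≡ : su (xs i) ≡ gu (x̂ i)
    su≡ = proj₁ (lifted-copyₛ (proj₁ mi))
    su≡′ : su (ys i) ≡ gv' (x̂ i)
    su≡′ = trans (proj₁ (lifted-copyₜ (proj₁ mi))) (proj₁ (matching-swap mi))
    from : xs i ⊏ ys i → gu (x̂ i) ≺ gv' (x̂ i)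
    from (inj₁ u≺v)        = subst₂ _≺_ su≡ su≡′ u≺v
    from (inj₂ (same , _)) =
      contradiction (trans (sym su≡) (trans same su≡′)) (valid-ends-distinct (proj₁ (matching-valid mi)))

  copies-inversion⇒≡ : ∀ {i j x y} → ValidG x → ValidG y → IsCopy (xs i) x → IsCopy (ys j) y →
    gu x ≡ gu y → gi y < gi x → i ≡ j
  copies-inversion⇒≡ {i} {j} vx vy cx cy same gy<gx = gadget-edge⇒≡ (proj₁ inversion) (proj₂ inversion)
    where
    inversion : su (xs i) ≡ su (ys j) × GadgetEdge (su (xs i)) (sq (xs i)) (sq (ys j))
    inversion = inversion-copies⇒gadgetEdge enum-ok vx vy cx cy same gy<gx
      (same-block-< (trans (proj₁ cx) (trans same (sym (proj₁ cy)))))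

  module Star (c : Fin n) (c∈ : ∀ {i} → Matching i → c ∈₂ X i) where
    -- The end of edge i lying in S(c), its anchor, is x̂ i if i is forward and ŷ i otherwise.
    Forward : Pred (Fin r) 0ℓ
    Forward i = c ≡ gu (x̂ i)

    forward? : Decidable Forward
    forward? i = c ≟ᶠ gu (x̂ i)

    backward-anchor : ∀ {i} → Matching i → ¬ Forward i → gu (ŷ i) ≡ c
    backward-anchor {i} mi ¬forward = from (c∈ mi)
      where
      from : c ∈₂ X i → gu (ŷ i) ≡ c
      from (inj₁ c≡) = contradiction c≡ ¬forward
      from (inj₂ c≡) = trans (proj₁ (matching-swap mi)) (sym c≡)

    forward-order : ∀ {i} → Matching i → Forward i → c ≺ gv' (x̂ i)
    forward-order {i} mi c≡ = subst (_≺ gv' (x̂ i)) (sym c≡) (matching-order mi)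

    backward-order : ∀ {i} → Matching i → ¬ Forward i → gv' (ŷ i) ≺ c
    backward-order mi ¬forward = subst₂ _≺_ (sym (proj₂ (matching-swap mi)))
      (trans (sym (proj₁ (matching-swap mi))) (backward-anchor mi ¬forward)) (matching-order mi)

    forward-below-backward : ∀ {j k} → Matching j → Forward j → Matching k → ¬ Forward k →
      gi (x̂ j) ≤ gi (ŷ k)
    forward-below-backward mj fj mk ¬fk = ≮⇒≥ λ gk<gj → ¬fk (subst Forward
      (copies-inversion⇒≡ (proj₁ (matching-valid mj)) (proj₂ (matching-valid mk))
        (lifted-copyₛ (proj₁ mj)) (lifted-copyₜ (proj₁ mk)) (trans (sym fj) (sym (backward-anchor mk ¬fk))) gk<gj)
      fj)

    threshold : ∃ λ s → s ≤ a × (∀ {i} → (Matching ∩ Forward) i → gi (x̂ i) ≤ s)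
                                × (∀ {j} → (Matching ∩ ∁ Forward) j → s ≤ gi (ŷ j))
    threshold = separator (matching? ∩? forward?) (gi ∘ x̂) (gi ∘ ŷ)
      (λ (mi , _) → <⇒≤ (proj₁ (proj₂ (proj₁ (matching-valid mi)))))
      (λ (mj , fj) (mk , ¬fk) → forward-below-backward mj fj mk ¬fk)

    s : ℕ
    s = proj₁ threshold

    s≤a : s ≤ a
    s≤a = proj₁ (proj₂ threshold)

    forward-layer≤s : ∀ {i} → Matching i → Forward i → gi (x̂ i) ≤ s
    forward-layer≤s mi forward = proj₁ (proj₂ (proj₂ threshold)) (mi , forward)

    s≤backward-layer : ∀ {i} → Matching i → ¬ Forward i → s ≤ gi (ŷ i)
    s≤backward-layer mi ¬forward = proj₂ (proj₂ (proj₂ threshold)) (mi , ¬forward)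

    -- Fw and Bw are the summands of fwdWeight c and backWeight c; wt v counts the positions of
    -- I(c, v) in layers ≤ s if c ≺ v, and in layers ≥ s if v ≺ c.
    Fw Bw wt : Fin n → ℕ
    Fw v = if adj v c ∧ does (c ≺? v) then ω v c else 0
    Bw v = if adj v c ∧ does (v ≺? c) then ω v c else 0
    wt v = suc s * (Fw v / a) + (a ∸ s) * (Bw v / a)

    total-weight : sum (map wt (allFin n)) ≤ (a + 1) * τ / a
    total-weight = *-cancelˡ-≤ a (begin
      a * Σ wt                           ≤⟨ *-sum-map-≤ (allFin n) {a} {suc s} {a ∸ s} wt Fw Bw pointwise ⟩
      suc s * Σ Fw + (a ∸ s) * Σ Bw      ≤⟨ +-mono-≤ (*-monoʳ-≤ (suc s) (proj₂ (balanced c)))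
                                                     (*-monoʳ-≤ (a ∸ s) (proj₁ (balanced c))) ⟩
      suc s * τ + (a ∸ s) * τ            ≡⟨ *-distribʳ-+ τ (suc s) (a ∸ s) ⟨
      suc (s + (a ∸ s)) * τ              ≡⟨ cong (λ k → suc k * τ) {s + (a ∸ s)} {a} (m+[n∸m]≡n s≤a) ⟩
      suc a * τ                          ≡⟨⟩
      a * ((a + 1) * τ / a)              ∎)
      where
      open ≤-Reasoning
      Σ : (Fin n → ℕ) → ℕ
      Σ f = sum (map f (allFin n))
      pointwise : ∀ v → a * wt v ≤ suc s * Fw v + (a ∸ s) * Bw v
      pointwise v = begin
        a * wt v                                              ≡⟨ *-distribˡ-+ a (suc s * (Fw v / a)) _ ⟩
        a * (suc s * (Fw v / a)) + a * ((a ∸ s) * (Bw v / a)) ≤⟨ +-mono-≤ (m*[n*[o/m]]≤n*o a (suc s) (Fw v))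
                                                                          (m*[n*[o/m]]≤n*o a (a ∸ s) (Bw v)) ⟩
        suc s * Fw v + (a ∸ s) * Bw v                         ∎

    forward-weight : ∀ {v} → adj c v ≡ true → c ≺ v → suc s * m H c v ≤ wt v
    forward-weight {v} cv c≺v = ≤-trans (≤-reflexive (cong (λ w → suc s * (w / a)) (sym Fw≡))) (m≤m+n _ _)
      where
      Fw≡ : Fw v ≡ ω c v
      Fw≡ = trans (cong (λ t → if t then ω v c else 0)
                        (cong₂ _∧_ (trans (adj-sym v c) cv) (dec-true (c ≺? v) c≺v)))
                  (sym (ω-sym c v cv))

    backward-weight : ∀ {v} → adj c v ≡ true → v ≺ c → (a ∸ s) * m H c v ≤ wt v
    backward-weight {v} cv v≺c = ≤-trans (≤-reflexive (cong (λ w → (a ∸ s) * (w / a)) (sym Bw≡))) (m≤n+m _ _)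
      where
      Bw≡ : Bw v ≡ ω c v
      Bw≡ = trans (cong (λ t → if t then ω v c else 0)
                        (cong₂ _∧_ (trans (adj-sym v c) cv) (dec-true (v ≺? c) v≺c)))
                  (sym (ω-sym c v cv))

    anchor : ∀ i → Dec (Forward i) → GV n
    anchor i (yes _) = x̂ i
    anchor i (no _)  = ŷ i

    layer : ∀ i → Dec (Forward i) → ℕ
    layer i (yes _) = gi (x̂ i)
    layer i (no _)  = gi (ŷ i) ∸ s

    index : ∀ i → Dec (Forward i) → ℕ
    index i d = layer i d * m H c (gv' (anchor i d)) + gk (anchor i d)

    anchor-valid : ∀ {i} → Matching i → (d : Dec (Forward i)) → ValidG (anchor i d) × gu (anchor i d) ≡ c
    anchor-valid mi (yes c≡)      = proj₁ (matching-valid mi) , sym c≡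
    anchor-valid mi (no ¬forward) = proj₂ (matching-valid mi) , backward-anchor mi ¬forward

    anchor-adj : ∀ {i} → Matching i → (d : Dec (Forward i)) → adj c (gv' (anchor i d)) ≡ true
    anchor-adj {i} mi d =
      subst (λ u → adj u (gv' (anchor i d)) ≡ true) (proj₂ (anchor-valid mi d)) (proj₁ (proj₁ (anchor-valid mi d)))

    anchor-gk< : ∀ {i} → Matching i → (d : Dec (Forward i)) → gk (anchor i d) < m H c (gv' (anchor i d))
    anchor-gk< {i} mi d = subst (λ u → gk (anchor i d) < m H u (gv' (anchor i d)))
      (proj₂ (anchor-valid mi d)) (proj₂ (proj₂ (proj₁ (anchor-valid mi d))))

    index< : ∀ {i} → Matching i → (d : Dec (Forward i)) → index i d < wt (gv' (anchor i d))
    index< mi d@(yes forward) = <-≤-trans (m*n+o<k*n (s≤s (forward-layer≤s mi forward)) (anchor-gk< mi d))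
      (forward-weight (anchor-adj mi d) (forward-order mi forward))
    index< {i} mi d@(no ¬forward) = <-≤-trans
      (m*n+o<k*n (∸-monoˡ-< (proj₁ (proj₂ (proj₂ (matching-valid mi)))) (s≤backward-layer mi ¬forward))
                 (anchor-gk< mi d))
      (backward-weight (anchor-adj mi d) (backward-order mi ¬forward))

    index-injective : ∀ {i j} → Matching i → Matching j → (d : Dec (Forward i)) (e : Dec (Forward j)) →
      gv' (anchor i d) ≡ gv' (anchor j e) → index i d ≡ index j e → i ≡ j
    index-injective mi mj (yes fi) (no ¬fj) v≡ _ =
      contradiction (subst (c ≺_) v≡ (forward-order mi fi)) (≺-asym (backward-order mj ¬fj))
    index-injective mi mj (no ¬fi) (yes fj) v≡ _ =
      contradiction (subst (c ≺_) (sym v≡) (forward-order mj fj)) (≺-asym (backward-order mi ¬fi))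
    index-injective {i} {j} mi mj d@(yes fi) e@(yes fj) v≡ eq =
      lifted-edge⇒≡ (subst (IsCopy (xs i)) x̂≡ (lifted-copyₛ (proj₁ mi)))
        (lifted-copyₜ (proj₁ mj)) (lifted-edgeG (proj₁ mj))
      where
      digits : gi (x̂ i) ≡ gi (x̂ j) × gk (x̂ i) ≡ gk (x̂ j)
      digits = *+-injective (gi (x̂ i)) (gi (x̂ j))
                 (anchor-gk< mi d) (subst (λ v → gk (x̂ j) < m H c v) (sym v≡) (anchor-gk< mj e))
                 (trans eq (cong (λ v → gi (x̂ j) * m H c v + gk (x̂ j)) (sym v≡)))
      x̂≡ : x̂ i ≡ x̂ j
      x̂≡ = gv-≡ (trans (sym fi) fj) v≡ (proj₁ digits) (proj₂ digits)
    index-injective {i} {j} mi mj d@(no ¬fi) e@(no ¬fj) v≡ eq =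
      lifted-edge⇒≡ (lifted-copyₛ (proj₁ mi))
        (subst (IsCopy (ys j)) (sym ŷ≡) (lifted-copyₜ (proj₁ mj))) (lifted-edgeG (proj₁ mi))
      where
      digits : gi (ŷ i) ∸ s ≡ gi (ŷ j) ∸ s × gk (ŷ i) ≡ gk (ŷ j)
      digits = *+-injective (gi (ŷ i) ∸ s) (gi (ŷ j) ∸ s)
                 (anchor-gk< mi d) (subst (λ v → gk (ŷ j) < m H c v) (sym v≡) (anchor-gk< mj e))
                 (trans eq (cong (λ v → (gi (ŷ j) ∸ s) * m H c v + gk (ŷ j)) (sym v≡)))
      ŷ≡ : ŷ i ≡ ŷ j
      ŷ≡ = gv-≡ (trans (backward-anchor mi ¬fi) (sym (backward-anchor mj ¬fj))) v≡
             (∸-cancelʳ-≡ (s≤backward-layer mi ¬fi) (s≤backward-layer mj ¬fj) (proj₁ digits))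
             (proj₂ digits)

    neighbour : Fin r → Fin n
    neighbour i = gv' (anchor i (forward? i))

    neighbour-bound : ∀ v → AtMost (Matching ∩ (λ i → neighbour i ≡ v)) (wt v)
    neighbour-bound v = record
      { code           = λ i → index i (forward? i)
      ; code<          = λ {i} (mi , v≡) →
          subst (λ w → index i (forward? i) < wt w) v≡ (index< mi (forward? i))
      ; code-injective = λ {i} {j} (mi , vi≡) (mj , vj≡) →
          index-injective mi mj (forward? i) (forward? j) (trans vi≡ (sym vj≡))
      }

    matching-bound-at : AtMost Matching ((a + 1) * τ / a)
    matching-bound-at = atMost-≤ total-weight
      (atMost-partition _≟ᶠ_ neighbour (allFin n) wt (λ _ → ∈-allFin _) neighbour-bound)

  matching-bound : AtMost Matching ((a + 1) * τ / a)
  matching-bound = atMost-inhabited matching? λ mf →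
    let (c , c∈) = intersecting-edges-share-vertex H triangle-free matching? X
                     (λ mi → proj₁ (proj₁ (matching-valid mi))) matching-meets mf
    in Star.matching-bound-at c c∈

  cut-bound : r ≤ bound
  cut-bound = atMost⇒≤ {P = U} _ (atMost-≤ (m≤m+n (21 + ((a + 1) * τ / a + 9)) 77)
    (atMost-split gadget? (atMost-⊆ proj₂ gadget-bound)
      (atMost-split (λ i → meets? (X i) (Y i))
        (atMost-⊆ (λ ((_ , li) , meets) → li , meets) matching-bound)
        (atMost-⊆ (λ ((_ , li) , ¬meets) → li , ¬meets) dummy-bound))))

lemma26 : (H : WGraph) → TriangleFree H → WeightsPosMultOf H a →
    (enum : Fin (WGraph.n H) → List (Fin (WGraph.n H))) → EnumOK H enum →
    (match : Fin (WGraph.n H) → Fin (WGraph.n H) → ℕ × ℕ → ℕ × ℕ) → MatchOK H match →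
    HasBalancingOrder H τ →
    Construction.LinMimWidthLe H enum match bound
lemma26 H triangle-free _ enum enum-ok match _ (_≺_ , sto , balanced) =
  layout , layout-linear , spine-cuts , leaf-cuts
  where
  open Construction H enum match
  open Layout H enum match sto

  spine-cuts : ∀ j → MimLe (_∈ take j layout) (_∈ drop j layout) bound
  spine-cuts j r xs ys in-prefix in-suffix edge induced =
    Cut.cut-bound H enum match sto triangle-free enum-ok balanced xs ys
      (λ i k → allPairs-take-drop j layout-increasing (in-prefix i) (in-suffix k)) edge induced

  leaf-cuts : ∀ s → s ∈ layout → MimLe (_≡ s) (λ t → ValidS t × t ≢ s) bound
  leaf-cuts s _ r xs ys at-s _ edge induced =
    ≤-trans (InducedMatching.common-source⇒≤1 EdgeS xs ys induced at-s edge) (s≤s z≤n)
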